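{- Let $n=p_1^{\alpha_1}p_2^{\alpha_2}\cdots p_k^{\alpha_k}$ be the prime power factorization of a composite integer $n$ (distinct primes $p_i$), with $\alpha_1\ge3$ if $k=1$, and let $u,v$ be two distinct vertices of $\Upsilon_n$ such that $u$ divides $v$. Then $\deg(u)\le\deg(v)$, and equality holds if and only if $k=1$, $u=p_1^{\lceil\alpha_1/2\rceil-1}$ and $v=p_1^{\lceil\alpha_1/2\rceil}$.
   Context: For an integer $n>1$, a proper divisor of $n$ is an integer $d$ with $1<d<n$ and $d\mid n$. The proper divisor graph $\Upsilon_n$ is the simple graph whose vertices are the proper divisors of $n$, two distinct vertices $u,v$ being adjacent iff $n\mid uv$. -}

module Defs where

open import Data.Nat using (ℕ; _<_; _*_; _≟_; _<?_)
open import Data.Nat.Divisibility using (_∣_; _∣?_)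
open import Data.List using (List; length; filter; upTo)
open import Data.Product using (_×_)
open import Relation.Nullary using (¬_; Dec)
open import Relation.Nullary.Decidable using (_×-dec_; ¬?)
open import Relation.Binary.PropositionalEquality using (_≢_)

IsVertex : ℕ → ℕ → Set
IsVertex n d = (1 < d) × (d < n) × (d ∣ n)

isVertex? : (n d : ℕ) → Dec (IsVertex n d)
isVertex? n d = (1 <? d) ×-dec ((d <? n) ×-dec (d ∣? n))

Adjacent : ℕ → ℕ → ℕ → Set
Adjacent n u w = (u ≢ w) × (n ∣ u * w)

vertices : ℕ → List ℕ
vertices n = filter (isVertex? n) (upTo n)

deg : ℕ → ℕ → ℕ
deg n u = length (filter (λ w → ¬? (u ≟ w) ×-dec (n ∣? u * w)) (vertices n))

-- Since u ∣ v, every neighbour w ≠ v of u is a neighbour of v (n ∣ uw ∣ vw), and v is a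
-- neighbour of u exactly when u is one of v. Hence deg u ≤ deg v, with equality iff every
-- neighbour of v other than u is a neighbour of u. Write v = t u and n = m v. If m ∉ {u, v},
-- the vertex m is adjacent to v but not to u; if m ∈ {u, v} and v has a prime divisor d ≠ t,
-- the vertex m d is. Otherwise t is prime and v is a power of t, which forces u = tᶜ,
-- v = tᶜ⁺¹ and n ∈ {u v, v²}, i.e. n = t²ᶜ⁺¹ or t²ᶜ⁺²: the exceptional pairs. For these, a
-- neighbour w ∉ {u, v} of v has the form w = r m with 1 < r ∣ v, so t ∣ r and w is a
-- neighbour of u.
module Submission where

open import Defs
open import Data.Nat
  using (ℕ; zero; suc; _≤_; _<_; _+_; _*_; _^_; _∸_; ⌈_/2⌉; _≟_; NonZero; z≤n; s≤s; z<s;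
         >-nonZero; nonTrivial⇒n>1)
open import Data.Nat.Properties
  using (m≤n⇒m≤1+n; m<n⇒m<1+n; +-suc; ≤-antisym; <-irrefl; +-monoˡ-≤; +-cancelʳ-≡; *-comm;
         suc-injective; ^-distribˡ-+-*; n≡⌊n+n/2⌋; n≡⌈n+n/2⌉; m*n≢0; m^n≢0; *-cancelˡ-≡;
         *-cancelʳ-≡; >⇒≢; ≤∧≢⇒<; <-≤-trans; ≤-<-trans; m<m*n; *-monoʳ-<; <⇒≱; <⇒≤; ≤-refl;
         <-trans; +-identityʳ; n≢0⇒n>0; n≮0; module ≤-Reasoning)
open import Data.Nat.Divisibility
  using (_∣_; _∣?_; divides; ∣-refl; ∣-trans; ∣1⇒≡1; ∣⇒≤; m∣m*n; ∣n⇒∣m*n; *-monoˡ-∣;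
         *-monoʳ-∣; *-cancelʳ-∣; *-cancelˡ-∣)
open import Data.Nat.ListAction using (product)
open import Data.Nat.Primality
  using (Prime; Composite; prime?; euclidsLemma; prime⇒irreducible; ¬prime[1]; prime⇒nonZero;
         prime⇒nonTrivial)
open import Data.Nat.Primality.Factorisation using (factorise; PrimeFactorisation)
open import Data.Nat.Tactic.RingSolver using (solve-∀)
open import Data.List using ([]; _∷_; [_]; length; filter; upTo)
open import Data.List.Properties using (filter-none; filter-reject)
open import Data.List.Membership.Propositional using (_∈_)
open import Data.List.Membership.Propositional.Properties using (∈-filter⁺; ∈-filter⁻; ∈-upTo⁺)
open import Data.List.Relation.Unary.All as All using (All; []; _∷_)
open import Data.List.Relation.Unary.Any using (here; there)
open import Data.List.Relation.Unary.Unique.Propositional using (Unique; _∷_)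
import Data.List.Relation.Unary.Unique.Propositional.Properties as Unique
open import Data.Product using (_×_; _,_; ∃-syntax; proj₁; proj₂)
open import Data.Sum using (_⊎_; inj₁; inj₂)
import Data.Sum as Sum
open import Function using (_∘_)
open import Function.Bundles using (_⇔_; mk⇔; Equivalence)
open import Function.Properties.Equivalence using () renaming (trans to ⇔-trans)
open import Level using (0ℓ)
open import Relation.Binary.Definitions using (DecidableEquality)
open import Relation.Binary.PropositionalEquality
  using (_≡_; _≢_; refl; sym; trans; cong; cong₂; subst; subst₂; ≢-sym; module ≡-Reasoning)
open import Relation.Nullary using (¬_; yes; no; contradiction)
open import Relation.Nullary.Decidable using (_×-dec_; ¬?; decidable-stable)
open import Relation.Unary using (Pred; Decidable; _⇒_)
open import Relation.Unary.Properties using (_∩?_; ∁?)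

module _ {A : Set} {P Q : Pred A 0ℓ} (P? : Decidable P) (Q? : Decidable Q) where

  length-filter-mono : ∀ {xs} → All (P ⇒ Q) xs → length (filter P? xs) ≤ length (filter Q? xs)
  length-filter-mono {[]}     []              = z≤n
  length-filter-mono {x ∷ xs} (px⇒qx ∷ p⇒q) with P? x | Q? x
  ... | yes px | no ¬qx = contradiction (px⇒qx px) ¬qx
  ... | yes _  | yes _  = s≤s (length-filter-mono p⇒q)
  ... | no _   | yes _  = m≤n⇒m≤1+n (length-filter-mono p⇒q)
  ... | no _   | no _   = length-filter-mono p⇒q

  length-filter-mono-< : ∀ {xs y} → All (P ⇒ Q) xs → y ∈ xs → Q y → ¬ P y →
                         length (filter P? xs) < length (filter Q? xs)
  length-filter-mono-< {x ∷ xs} (_ ∷ p⇒q) (here refl) qx ¬px with P? x | Q? x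
  ... | yes px | _      = contradiction px ¬px
  ... | no _   | no ¬qx = contradiction qx ¬qx
  ... | no _   | yes _  = s≤s (length-filter-mono p⇒q)
  length-filter-mono-< {x ∷ xs} (px⇒qx ∷ p⇒q) (there y∈xs) qy ¬py with P? x | Q? x
  ... | yes px | no ¬qx = contradiction (px⇒qx px) ¬qx
  ... | yes _  | yes _  = s≤s (length-filter-mono-< p⇒q y∈xs qy ¬py)
  ... | no _   | yes _  = m<n⇒m<1+n (length-filter-mono-< p⇒q y∈xs qy ¬py)
  ... | no _   | no _   = length-filter-mono-< p⇒q y∈xs qy ¬py

  length-filter-[]-cong : ∀ {x y} → P x ⇔ Q y →
                          length (filter P? [ x ]) ≡ length (filter Q? [ y ])
  length-filter-[]-cong {x} {y} px⇔qy with P? x | Q? y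
  ... | yes _  | yes _  = refl
  ... | no _   | no _   = refl
  ... | yes px | no ¬qy = contradiction (Equivalence.to px⇔qy px) ¬qy
  ... | no ¬px | yes qy = contradiction (Equivalence.from px⇔qy qy) ¬px

module _ {A : Set} {P Q : Pred A 0ℓ} (P? : Decidable P) (Q? : Decidable Q) where

  length-filter-≡⇔ : ∀ {xs} → All (P ⇒ Q) xs →
                     length (filter P? xs) ≡ length (filter Q? xs) ⇔ All (Q ⇒ P) xs
  length-filter-≡⇔ p⇒q = mk⇔
    (λ eq → All.tabulate λ {x} x∈xs qx → decidable-stable (P? x) λ ¬px →
      <-irrefl eq (length-filter-mono-< P? Q? p⇒q x∈xs qx ¬px))
    (λ q⇒p → ≤-antisym (length-filter-mono P? Q? p⇒q) (length-filter-mono Q? P? q⇒p))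

module _ {A : Set} {P X : Pred A 0ℓ} (P? : Decidable P) (X? : Decidable X) where

  length-filter-split : ∀ xs → length (filter P? xs) ≡
                        length (filter (P? ∩? ∁? X?) xs) + length (filter (P? ∩? X?) xs)
  length-filter-split []       = refl
  length-filter-split (x ∷ xs) with P? x | X? x
  ... | yes _ | yes _ = trans (cong suc (length-filter-split xs)) (sym (+-suc _ _))
  ... | yes _ | no _  = cong suc (length-filter-split xs)
  ... | no _  | yes _ = length-filter-split xs
  ... | no _  | no _  = length-filter-split xs

module _ {A : Set} (_≟_ : DecidableEquality A) {P : Pred A 0ℓ} (P? : Decidable P) where

  length-filter-∩≟-∉ : ∀ {xs x} → All (x ≢_) xs → length (filter (P? ∩? (_≟ x)) xs) ≡ 0
  length-filter-∩≟-∉ x∉xs =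
    cong length (filter-none (P? ∩? (_≟ _)) (All.map (λ x≢y → x≢y ∘ sym ∘ proj₂) x∉xs))

  length-filter-∩≟ : ∀ {xs x} → Unique xs → x ∈ xs →
                     length (filter (P? ∩? (_≟ x)) xs) ≡ length (filter P? [ x ])
  length-filter-∩≟ {x ∷ xs} (x∉xs ∷ _) (here refl) with P? x | x ≟ x
  ... | _     | no x≢x = contradiction refl x≢x
  ... | yes _ | yes _  = cong suc (length-filter-∩≟-∉ x∉xs)
  ... | no _  | yes _  = length-filter-∩≟-∉ x∉xs
  length-filter-∩≟ {y ∷ xs} {x} (y∉xs ∷ unique) (there x∈xs) =
    trans (cong length (filter-reject (P? ∩? (_≟ x)) (All.lookup y∉xs x∈xs ∘ proj₂)))
          (length-filter-∩≟ unique x∈xs)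

1<⇒nonZero : ∀ {m} → 1 < m → NonZero m
1<⇒nonZero 1<m = >-nonZero (<-trans z<s 1<m)

prime-divisor : ∀ {m} → 1 < m → ∃[ p ] (Prime p × p ∣ m)
prime-divisor {m} 1<m with factorise m {{1<⇒nonZero 1<m}}
... | record { factors = [] ; isFactorisation = m≡1 } = contradiction m≡1 (>⇒≢ 1<m)
... | record { factors = p ∷ ps ; isFactorisation = m≡pΠ ; factorsPrime = p-prime ∷ _ } =
  p , p-prime , divides (product ps) (trans m≡pΠ (*-comm p (product ps)))

product≡^⊎otherPrime : ∀ t {ps} → All Prime ps →
                       product ps ≡ t ^ length ps ⊎ ∃[ d ] (Prime d × d ∣ product ps × d ≢ t)
product≡^⊎otherPrime t [] = inj₁ refl
product≡^⊎otherPrime t {p ∷ ps} (p-prime ∷ ps-prime) with p ≟ t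
... | no p≢t   = inj₂ (p , p-prime , m∣m*n (product ps) , p≢t)
... | yes refl = Sum.map (cong (t *_))
                         (λ (d , d-prime , d∣Π , d≢t) → d , d-prime , ∣n⇒∣m*n t d∣Π , d≢t)
                         (product≡^⊎otherPrime t ps-prime)

^⊎otherPrimeDivisor : ∀ t m .{{_ : NonZero m}} →
                      (∃[ b ] m ≡ t ^ b) ⊎ ∃[ d ] (Prime d × d ∣ m × d ≢ t)
^⊎otherPrimeDivisor t m =
  Sum.map (λ eq → length factors , trans isFactorisation eq)
          (λ (d , d-prime , d∣Π , d≢t) → d , d-prime , subst (d ∣_) (sym isFactorisation) d∣Π , d≢t)
          (product≡^⊎otherPrime t factorsPrime)
  where open PrimeFactorisation (factorise m)

primePower⊎otherPrimeDivisor : ∀ {t m} .{{_ : NonZero m}} → 1 < t → t ∣ m →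
                               (Prime t × ∃[ b ] m ≡ t ^ b) ⊎ ∃[ d ] (Prime d × d ∣ m × d ≢ t)
primePower⊎otherPrimeDivisor {t} {m} 1<t t∣m with prime? t
... | yes t-prime = Sum.map₁ (t-prime ,_) (^⊎otherPrimeDivisor t m)
... | no ¬t-prime with prime-divisor 1<t
...   | d , d-prime , d∣t = inj₂ (d , d-prime , ∣-trans d∣t t∣m , λ { refl → ¬t-prime d-prime })

prime∣^⇒≡ : ∀ {p q} k → Prime p → Prime q → q ∣ p ^ k → q ≡ p
prime∣^⇒≡ zero _ q-prime q∣1 = contradiction (subst Prime (∣1⇒≡1 q∣1) q-prime) ¬prime[1]
prime∣^⇒≡ {p} (suc k) p-prime q-prime q∣p^k+1 with euclidsLemma p (p ^ k) q-prime q∣p^k+1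
... | inj₂ q∣p^k = prime∣^⇒≡ k p-prime q-prime q∣p^k
... | inj₁ q∣p with prime⇒irreducible p-prime q∣p
...   | inj₁ q≡1 = contradiction (subst Prime q≡1 q-prime) ¬prime[1]
...   | inj₂ q≡p = q≡p

prime∣nontrivial-divisor-of-^ : ∀ {p r} k → Prime p → 1 < r → r ∣ p ^ k → p ∣ r
prime∣nontrivial-divisor-of-^ k p-prime 1<r r∣p^k with prime-divisor 1<r
... | q , q-prime , q∣r = subst (_∣ _) (prime∣^⇒≡ k p-prime q-prime (∣-trans q∣r r∣p^k)) q∣r

⌈n/2⌉+⌈n/2⌉≡n⊎1+n : ∀ n → ⌈ n /2⌉ + ⌈ n /2⌉ ≡ n ⊎ ⌈ n /2⌉ + ⌈ n /2⌉ ≡ suc n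
⌈n/2⌉+⌈n/2⌉≡n⊎1+n zero          = inj₁ refl
⌈n/2⌉+⌈n/2⌉≡n⊎1+n (suc zero)    = inj₂ refl
⌈n/2⌉+⌈n/2⌉≡n⊎1+n (suc (suc n)) = Sum.map step step (⌈n/2⌉+⌈n/2⌉≡n⊎1+n n)
  where
  step : ∀ {c m} → c + c ≡ m → suc c + suc c ≡ suc (suc m)
  step {c} eq = cong suc (trans (+-suc c c) (cong suc eq))

adjacent? : ∀ n u → Decidable (Adjacent n u)
adjacent? n u w = ¬? (u ≟ w) ×-dec (n ∣? u * w)

adjacent-sym : ∀ {n u w} → Adjacent n u w → Adjacent n w u
adjacent-sym {n} {u} {w} (u≢w , n∣uw) = ≢-sym u≢w , subst (n ∣_) (*-comm u w) n∣uw

∈-vertices⁺ : ∀ {n x} → IsVertex n x → x ∈ vertices n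
∈-vertices⁺ {n} x-vertex@(_ , x<n , _) = ∈-filter⁺ (isVertex? n) (∈-upTo⁺ x<n) x-vertex

∈-vertices⁻ : ∀ {n x} → x ∈ vertices n → IsVertex n x
∈-vertices⁻ {n} x∈ = proj₂ (∈-filter⁻ (isVertex? n) {xs = upTo n} x∈)

vertices-unique : ∀ n → Unique (vertices n)
vertices-unique n = Unique.filter⁺ (isVertex? n) (Unique.upTo⁺ n)

Dominates : ℕ → ℕ → ℕ → Set
Dominates n u v = ∀ {w} → IsVertex n w → w ≢ u → Adjacent n v w → Adjacent n u w

module _ {n u v : ℕ} (u-vertex : IsVertex n u) (v-vertex : IsVertex n v) where

  private
    AdjacentExcept : ℕ → ℕ → ℕ → Set
    AdjacentExcept x y w = Adjacent n x w × w ≢ y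

    degExcept : ℕ → ℕ → ℕ
    degExcept x y = length (filter (adjacent? n x ∩? ∁? (_≟ y)) (vertices n))

    adjacentTo : ℕ → ℕ → ℕ
    adjacentTo x y = length (filter (adjacent? n x) [ y ])

    deg-split : ∀ x y → IsVertex n y → deg n x ≡ degExcept x y + adjacentTo x y
    deg-split x y y-vertex = trans (length-filter-split (adjacent? n x) (_≟ y) (vertices n))
      (cong (degExcept x y +_)
            (length-filter-∩≟ _≟_ (adjacent? n x) (vertices-unique n) (∈-vertices⁺ y-vertex)))

    deg-split-v : deg n v ≡ degExcept v u + adjacentTo u v
    deg-split-v = trans (deg-split v u u-vertex) (cong (degExcept v u +_) (sym adjacentTo-sym))
      where
      adjacentTo-sym : adjacentTo u v ≡ adjacentTo v u
      adjacentTo-sym =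
        length-filter-[]-cong (adjacent? n u) (adjacent? n v) (mk⇔ adjacent-sym adjacent-sym)

    adjacentExcept-mono : u ∣ v → All (AdjacentExcept u v ⇒ AdjacentExcept v u) (vertices n)
    adjacentExcept-mono u∣v = All.universal (λ w ((u≢w , n∣uw) , w≢v) →
      (≢-sym w≢v , ∣-trans n∣uw (*-monoˡ-∣ w u∣v)) , ≢-sym u≢w) _

  deg≤deg : u ∣ v → deg n u ≤ deg n v
  deg≤deg u∣v = begin
    deg n u                         ≡⟨ deg-split u v v-vertex ⟩
    degExcept u v + adjacentTo u v  ≤⟨ +-monoˡ-≤ _ (length-filter-mono _ _ (adjacentExcept-mono u∣v)) ⟩
    degExcept v u + adjacentTo u v  ≡⟨ deg-split-v ⟨
    deg n v                         ∎
    where open ≤-Reasoning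

  deg≡deg⇔dominates : u ∣ v → deg n u ≡ deg n v ⇔ Dominates n u v
  deg≡deg⇔dominates u∣v =
    ⇔-trans deg≡⇔degExcept≡ (⇔-trans (length-filter-≡⇔ _ _ (adjacentExcept-mono u∣v)) all⇔dominates)
    where
    deg≡⇔degExcept≡ : deg n u ≡ deg n v ⇔ degExcept u v ≡ degExcept v u
    deg≡⇔degExcept≡ = mk⇔
      (λ eq → +-cancelʳ-≡ (adjacentTo u v) _ _
                (trans (sym (deg-split u v v-vertex)) (trans eq deg-split-v)))
      (λ eq → trans (deg-split u v v-vertex) (trans (cong (_+ adjacentTo u v) eq) (sym deg-split-v)))
    all⇔dominates : All (AdjacentExcept v u ⇒ AdjacentExcept u v) (vertices n) ⇔ Dominates n u v
    all⇔dominates = mk⇔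
      (λ all {w} w-vertex w≢u vw → proj₁ (All.lookup all (∈-vertices⁺ w-vertex) (vw , w≢u)))
      (λ dom → All.tabulate λ w∈ (vw , w≢u) → dom (∈-vertices⁻ w∈) w≢u vw , ≢-sym (proj₁ vw))

Exceptional : ℕ → ℕ → ℕ → Set
Exceptional n u v =
  ∃[ p ] ∃[ α ] (Prime p × n ≡ p ^ α × u ≡ p ^ (⌈ α /2⌉ ∸ 1) × v ≡ p ^ ⌈ α /2⌉)

MiddlePowers : ℕ → ℕ → ℕ → Set
MiddlePowers n u v = ∃[ p ] ∃[ c ] (Prime p × u ≡ p ^ c × v ≡ p * u × (n ≡ u * v ⊎ n ≡ v * v))

exceptional-intro : ∀ {n p α} c → Prime p → n ≡ p ^ α → suc c ≡ ⌈ α /2⌉ →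
                    Exceptional n (p ^ c) (p ^ suc c)
exceptional-intro {p = p} {α} c p-prime n≡p^α c+1≡ =
  p , α , p-prime , n≡p^α , cong (λ e → p ^ (e ∸ 1)) c+1≡ , cong (p ^_) c+1≡

middlePowers⇒exceptional : ∀ {n u v} → MiddlePowers n u v → Exceptional n u v
middlePowers⇒exceptional (p , c , p-prime , refl , refl , inj₁ n≡uv) =
  exceptional-intro c p-prime
    (trans n≡uv (trans (*-comm (p ^ c) (p ^ suc c)) (sym (^-distribˡ-+-* p (suc c) c))))
    (cong suc (n≡⌊n+n/2⌋ c))
middlePowers⇒exceptional (p , c , p-prime , refl , refl , inj₂ n≡vv) =
  exceptional-intro c p-prime
    (trans n≡vv (sym (^-distribˡ-+-* p (suc c) (suc c))))
    (n≡⌈n+n/2⌉ (suc c))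

exceptional⇒middlePowers : ∀ {n u v} → 1 < u → Exceptional n u v → MiddlePowers n u v
exceptional⇒middlePowers {n} {u} {v} 1<u (p , α , p-prime , n≡p^α , u≡ , v≡)
  with ⌈ α /2⌉ | ⌈n/2⌉+⌈n/2⌉≡n⊎1+n α
... | zero  | _      = contradiction u≡ (>⇒≢ 1<u)
... | suc c | parity =
  p , c , p-prime , u≡ , trans v≡ (cong (p *_) (sym u≡)) , Sum.swap (Sum.map even odd parity)
  where
  n≡p^ : ∀ {e} → e ≡ α → n ≡ p ^ e
  n≡p^ e≡α = trans n≡p^α (cong (p ^_) (sym e≡α))
  even : suc c + suc c ≡ α → n ≡ v * v
  even 2c+2≡α = trans (n≡p^ 2c+2≡α)
                      (trans (^-distribˡ-+-* p (suc c) (suc c)) (sym (cong₂ _*_ v≡ v≡)))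
  odd : suc c + suc c ≡ suc α → n ≡ u * v
  odd 2c+2≡α+1 = trans (n≡p^ (suc-injective 2c+2≡α+1))
                       (trans (^-distribˡ-+-* p c (suc c)) (sym (cong₂ _*_ u≡ v≡)))

middlePowers⇒dominates : ∀ {n u v} → MiddlePowers n u v → Dominates n u v
middlePowers⇒dominates {n} (p , c , p-prime , refl , refl , n≡) {w} (1<w , _ , w∣n) w≢u (v≢w , n∣vw) =
  ≢-sym w≢u , Sum.[ (λ n≡uv → cofactor∣ (p ^ c) n≡uv w≢u)
                  , (λ n≡vv → cofactor∣ (p ^ suc c) n≡vv (≢-sym v≢w)) ] n≡
  where
  instance
    p≢0 : NonZero p
    p≢0 = prime⇒nonZero p-prime
    u≢0 : NonZero (p ^ c)
    u≢0 = m^n≢0 p c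
    v≢0 : NonZero (p ^ suc c)
    v≢0 = m^n≢0 p (suc c)
  cofactor∣ : ∀ s .{{_ : NonZero s}} → n ≡ s * p ^ suc c → w ≢ s → n ∣ p ^ c * w
  cofactor∣ s n≡sv w≢s
    with *-cancelʳ-∣ (p ^ suc c) (subst₂ _∣_ n≡sv (*-comm (p ^ suc c) w) n∣vw)
  ... | divides zero w≡0 = contradiction w≡0 (>⇒≢ (<-trans z<s 1<w))
  ... | divides (suc zero) w≡s+0 = contradiction (trans w≡s+0 (+-identityʳ s)) w≢s
  ... | divides r@(suc (suc _)) w≡rs
    with prime∣nontrivial-divisor-of-^ (suc c) p-prime (s≤s (s≤s z≤n)) r∣v
    where
    r∣v : r ∣ p ^ suc c
    r∣v = *-cancelʳ-∣ s (subst₂ _∣_ w≡rs (trans n≡sv (*-comm s _)) w∣n)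
  ...   | divides q r≡qp = divides q (begin
    p ^ c * w               ≡⟨ cong (p ^ c *_) (trans w≡rs (cong (_* s) r≡qp)) ⟩
    p ^ c * (q * p * s)     ≡⟨ rearrange (p ^ c) q p s ⟩
    q * (s * (p * p ^ c))   ≡⟨ cong (q *_) n≡sv ⟨
    q * n                   ∎)
    where
    open ≡-Reasoning
    rearrange : ∀ u q p s → u * (q * p * s) ≡ q * (s * (p * u))
    rearrange = solve-∀

Separating : ℕ → ℕ → ℕ → ℕ → Set
Separating n u v x = IsVertex n x × x ≢ u × Adjacent n v x × ¬ n ∣ u * x

module _ {n u v t : ℕ} (u-vertex : IsVertex n u) (v-vertex : IsVertex n v) (u≢v : u ≢ v)
         (v≡tu : v ≡ t * u) where

  private
    1<u : 1 < u
    1<u = proj₁ u-vertex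
    1<v : 1 < v
    1<v = proj₁ v-vertex
    v<n : v < n
    v<n = proj₁ (proj₂ v-vertex)
    instance
      u≢0 : NonZero u
      u≢0 = 1<⇒nonZero 1<u
      v≢0 : NonZero v
      v≢0 = 1<⇒nonZero 1<v
    t∣v : t ∣ v
    t∣v = divides u (trans v≡tu (*-comm t u))
    u<v : u < v
    u<v = ≤∧≢⇒< (∣⇒≤ (divides t v≡tu)) u≢v
    1<t : 1 < t
    1<t = ≤∧≢⇒< (n≢0⇒n>0 λ { refl → >⇒≢ (<-trans z<s 1<v) v≡tu })
                λ { refl → u≢v (sym (trans v≡tu (+-identityʳ u))) }

  cofactor-separating : ∀ {m} → n ≡ m * v → m ≢ u → m ≢ v → Separating n u v m
  cofactor-separating {zero}     n≡0   _ _ = contradiction (subst (v <_) n≡0 v<n) n≮0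
  cofactor-separating {suc zero} n≡v+0 _ _ = contradiction (trans n≡v+0 (+-identityʳ v)) (>⇒≢ v<n)
  cofactor-separating {m@(suc (suc _))} n≡mv m≢u m≢v =
    (s≤s (s≤s z≤n) , m<n , divides v n≡vm) , m≢u ,
    (≢-sym m≢v , subst (_∣ v * m) (sym n≡vm) ∣-refl) , n∤um
    where
    n≡vm : n ≡ v * m
    n≡vm = trans n≡mv (*-comm m v)
    m<n : m < n
    m<n = subst (m <_) (sym n≡mv) (m<m*n m v 1<v)
    n∤um : ¬ n ∣ u * m
    n∤um n∣um = <⇒≱ u<v (∣⇒≤ (*-cancelˡ-∣ m (subst₂ _∣_ n≡mv (*-comm u m) n∣um)))

  multiple-separating : ∀ {s d} → n ≡ s * v → s ≡ u ⊎ s ≡ v → Prime d → d ∣ v → d ≢ t →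
                        Separating n u v (s * d)
  multiple-separating {s} {d} n≡sv s∈uv d-prime d∣v d≢t =
    (<-trans 1<s s<sd , subst (s * d <_) (sym n≡sv) (*-monoʳ-< s d<v) ,
     subst (s * d ∣_) (sym n≡sv) (*-monoʳ-∣ s d∣v)) ,
    >⇒≢ (≤-<-trans u≤s s<sd) , (sd≢v ∘ sym , divides d vsd≡dn) , n∤usd
    where
    1<d : 1 < d
    1<d = nonTrivial⇒n>1 d {{prime⇒nonTrivial d-prime}}
    t∤d : ¬ t ∣ d
    t∤d t∣d = Sum.[ >⇒≢ 1<t , d≢t ∘ sym ] (prime⇒irreducible d-prime t∣d)
    d<v : d < v
    d<v = ≤∧≢⇒< (∣⇒≤ d∣v) λ { refl → t∤d t∣v }
    u≤s : u ≤ s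
    u≤s = Sum.[ (λ { refl → ≤-refl }) , (λ { refl → <⇒≤ u<v }) ] s∈uv
    1<s : 1 < s
    1<s = <-≤-trans 1<u u≤s
    instance
      s≢0 : NonZero s
      s≢0 = 1<⇒nonZero 1<s
    s<sd : s < s * d
    s<sd = m<m*n s d 1<d
    sd≢v : s * d ≢ v
    sd≢v = Sum.[ (λ { refl ud≡v → d≢t (*-cancelʳ-≡ d t u (trans (*-comm d u) (trans ud≡v v≡tu))) })
               , (λ { refl → >⇒≢ s<sd }) ] s∈uv
    vsd≡dn : v * (s * d) ≡ d * n
    vsd≡dn = trans (rearrange v s d) (cong (d *_) (sym n≡sv))
      where
      rearrange : ∀ v s d → v * (s * d) ≡ d * (s * v)
      rearrange = solve-∀
    n∤usd : ¬ n ∣ u * (s * d)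
    n∤usd n∣usd = t∤d (*-cancelˡ-∣ (s * u) {{m*n≢0 s u}} (subst₂ _∣_ n≡sut (rearrangeʳ u s d) n∣usd))
      where
      rearrangeˡ : ∀ s t u → s * (t * u) ≡ s * u * t
      rearrangeˡ = solve-∀
      rearrangeʳ : ∀ u s d → u * (s * d) ≡ s * u * d
      rearrangeʳ = solve-∀
      n≡sut : n ≡ s * u * t
      n≡sut = trans n≡sv (trans (cong (s *_) v≡tu) (rearrangeˡ s t u))

  cofactor∈uv⇒middlePowers⊎separating : ∀ {s} → n ≡ s * v → s ≡ u ⊎ s ≡ v →
                                        MiddlePowers n u v ⊎ ∃[ x ] Separating n u v x
  cofactor∈uv⇒middlePowers⊎separating {s} n≡sv s∈uv with primePower⊎otherPrimeDivisor 1<t t∣v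
  ... | inj₂ (d , d-prime , d∣v , d≢t) =
    inj₂ (s * d , multiple-separating n≡sv s∈uv d-prime d∣v d≢t)
  ... | inj₁ (t-prime , zero , v≡1) = contradiction v≡1 (>⇒≢ 1<v)
  ... | inj₁ (t-prime , suc c , v≡t^c+1) =
    inj₁ (t , c , t-prime , *-cancelˡ-≡ u (t ^ c) t {{prime⇒nonZero t-prime}} (trans (sym v≡tu) v≡t^c+1) ,
          v≡tu , Sum.[ (λ { refl → inj₁ n≡sv }) , (λ { refl → inj₂ n≡sv }) ] s∈uv)

middlePowers⊎separating : ∀ {n u v} → IsVertex n u → IsVertex n v → u ≢ v → u ∣ v →
                          MiddlePowers n u v ⊎ ∃[ x ] Separating n u v x
middlePowers⊎separating {u = u} {v} u-vertex v-vertex@(_ , _ , divides m n≡mv) u≢v (divides t v≡tu)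
  with m ≟ u | m ≟ v
... | yes refl | _        =
  cofactor∈uv⇒middlePowers⊎separating {t = t} u-vertex v-vertex u≢v v≡tu n≡mv (inj₁ refl)
... | no _     | yes refl =
  cofactor∈uv⇒middlePowers⊎separating {t = t} u-vertex v-vertex u≢v v≡tu n≡mv (inj₂ refl)
... | no m≢u   | no m≢v   =
  inj₂ (m , cofactor-separating {t = t} u-vertex v-vertex u≢v v≡tu n≡mv m≢u m≢v)

dominates⇔exceptional : ∀ {n u v} → IsVertex n u → IsVertex n v → u ≢ v → u ∣ v →
                        Dominates n u v ⇔ Exceptional n u v
dominates⇔exceptional u-vertex v-vertex u≢v u∣v = mk⇔
  (λ dominates → Sum.[ middlePowers⇒exceptional
                     , (λ (x , x-vertex , x≢u , vx , n∤ux) →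
                          contradiction (proj₂ (dominates x-vertex x≢u vx)) n∤ux) ]
                     (middlePowers⊎separating u-vertex v-vertex u≢v u∣v))
  (middlePowers⇒dominates ∘ exceptional⇒middlePowers (proj₁ u-vertex))

-- Compositeness and the bound 3 ≤ α are unused: they only guarantee that two distinct
-- vertices u ∣ v exist.
proposition2p7 : (n : ℕ) → Composite n
    → ((p α : ℕ) → Prime p → n ≡ p ^ α → 3 ≤ α)
    → (u v : ℕ) → IsVertex n u → IsVertex n v → u ≢ v → u ∣ v
    → (deg n u ≤ deg n v)
      × ((deg n u ≡ deg n v)
         ⇔ (∃[ p ] ∃[ α ] (Prime p × n ≡ p ^ α × u ≡ p ^ (⌈ α /2⌉ ∸ 1) × v ≡ p ^ ⌈ α /2⌉)))
proposition2p7 n _ _ u v u-vertex v-vertex u≢v u∣v =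
  deg≤deg u-vertex v-vertex u∣v ,
  ⇔-trans (deg≡deg⇔dominates u-vertex v-vertex u∣v) (dominates⇔exceptional u-vertex v-vertex u≢v u∣v)
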